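{- For every $n\ge1$, the number of permutations $\pi$ of $\{1,\dots,n\}$ such that $\mathrm{Flatten}(\pi)$ has no occurrence of the pattern 13-2 is $2^{n-1}$.
   Context: The standard cycle form of a permutation $\sigma$ of $\{1,\dots,n\}$ writes $\sigma$ as a product of disjoint cycles (fixed points included as 1-cycles), each cycle written starting with its smallest letter, the cycles arranged in increasing order of their smallest letters. $\mathrm{Flatten}(\sigma)$ is the word obtained by erasing the parentheses of the standard cycle form. An occurrence of the pattern 13-2 in a word $w_1\cdots w_n$ is a pair of indices $(i,j)$ with $2\le i<j\le n$ and $w_{i-1}<w_j<w_i$. -}

module Defs where

open import Data.Nat using (ℕ; zero; suc; _<_)
open import Data.Fin using (Fin; toℕ; _≟_)
open import Data.Fin.Properties using () renaming (_≟_ to _≟ᶠ_)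
open import Data.List using (List; []; _∷_; _++_; length; allFin)
import Data.List.Membership.DecPropositional as DM
open import Data.Vec using (Vec; lookup; toList)
open import Data.List.Relation.Unary.Unique.Propositional using (Unique)
open import Data.Bool using (Bool; true; false; if_then_else_)
open import Data.Product using (Σ; _×_; ∃)
open import Relation.Binary.PropositionalEquality using (_≡_)
open import Relation.Nullary using (does)

-- A permutation of {1..n} in one-line notation: a vector v with
-- v[i] = σ(i) (letters are Fin n, i.e. shifted down by one) with no
-- repeated entries (an injective self-map of a finite set is a bijection).
IsPerm : {n : ℕ} → Vec (Fin n) n → Set
IsPerm v = Unique (toList v)

cycleFrom : {n : ℕ} → Vec (Fin n) n → Fin n → Fin n → ℕ → List (Fin n)
cycleFrom σ start cur zero = []
cycleFrom σ start cur (suc fuel) =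
  cur ∷ (if does (lookup σ cur ≟ᶠ start) then [] else cycleFrom σ start (lookup σ cur) fuel)

-- Scan the letters in increasing order; each not-yet-visited letter is the
-- smallest letter of its cycle, so we output that cycle starting from it.
-- This yields the standard cycle form with parentheses erased.
flattenGo : {n : ℕ} → Vec (Fin n) n → List (Fin n) → List (Fin n) → List (Fin n)
flattenGo σ visited [] = []
flattenGo {n} σ visited (i ∷ is) =
  if does (DM._∈?_ (_≟ᶠ_ {n}) i visited)
  then flattenGo σ visited is
  else (let c = cycleFrom σ i i n in c ++ flattenGo σ (visited ++ c) is)

Flatten : {n : ℕ} → Vec (Fin n) n → List (Fin n)
Flatten {n} σ = flattenGo σ [] (allFin n)

-- An occurrence of 13-2: w = xs ++ a ∷ b ∷ ys ++ c ∷ zs with a < c < b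
-- (a = w_{i-1}, b = w_i, c = w_j, i < j).
Occ13-2 : {n : ℕ} → List (Fin n) → Set
Occ13-2 {n} w = Σ (List (Fin n)) λ xs → Σ (Fin n) λ a → Σ (Fin n) λ b →
  Σ (List (Fin n)) λ ys → Σ (Fin n) λ c → Σ (List (Fin n)) λ zs →
  (w ≡ xs ++ (a ∷ b ∷ (ys ++ (c ∷ zs)))) × (toℕ a < toℕ c) × (toℕ c < toℕ b)

-- Let σ be a permutation of {0, …, n−1} whose flattened cycle form avoids 13-2, and suppose the
-- letters below k make up whole cycles. The next cycle then starts at k, and every letter ≥ k
-- occurs later in the word. Once this cycle has been read as k, k+1, …, k+j, the next letter
-- σ(k+j) is k or k+j+1: it is ≥ k, a value in (k, k+j] is already σ of its predecessor
-- (injectivity), and a value b > k+j+1 makes k+j, b, k+j+1 an occurrence of 13-2.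
-- So σ is the product of the cycles (k k+1 … k+l) over the blocks of a composition of n, and
-- conversely each such σ flattens to 0 1 … n−1. There are 2^(n−1) compositions of n.

module Submission where

open import Defs
open import Data.Bool using (if_then_else_)
open import Data.Empty using (⊥-elim)
open import Data.Fin using (Fin; toℕ)
import Data.Fin as Fin
open import Data.Fin.Properties using (toℕ-injective; toℕ<n; toℕ-fromℕ<)
open import Data.List using (List; []; _∷_; _++_; [_]; length; map; allFin)
import Data.List as List
open import Data.List.Properties using (++-assoc; map-++; length-++; length-map; ∷-injectiveˡ; ∷-injectiveʳ)
import Data.List.Properties as Listₚ
open import Data.List.Membership.Propositional using (_∈_; _∉_)
open import Data.List.Membership.Propositional.Properties using (∈-++⁺ˡ; ∈-++⁺ʳ; ∈-++⁻; ∈-map⁺; ∈-map⁻; ∈-∃++)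
import Data.List.Membership.DecPropositional as DecMembership
open import Data.List.Relation.Unary.Any using (here; there)
open import Data.List.Relation.Unary.All as All using (All)
import Data.List.Relation.Unary.All.Properties as Allₚ
import Data.List.Relation.Unary.AllPairs.Properties as AllPairsₚ
open import Data.List.Relation.Unary.Unique.Propositional using (Unique; []; _∷_)
import Data.List.Relation.Unary.Unique.Propositional.Properties as Uniqueₚ
open import Data.Nat using (ℕ; zero; suc; _+_; _∸_; _^_; _≤_; _<_; z≤n; s≤s; z<s; _≟_; _<?_)
open import Data.Nat.Properties
open import Data.Nat.DivMod using (_mod_; m<n⇒m%n≡m)
open import Data.Nat.Induction using (<-wellFounded)
open import Data.List.Membership.DecPropositional _≟_ using (_∈?_)
open import Data.Product using (Σ; _×_; _,_; proj₁; proj₂)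
open import Data.Sum using (_⊎_; inj₁; inj₂)
open import Data.Vec using (Vec; _∷_; lookup; tabulate; toList)
open import Data.Vec.Properties using (lookup∘tabulate; tabulate∘lookup; tabulate-cong)
open import Data.Vec.Membership.Propositional.Properties using (∈-lookup; ∈-toList⁺)
open import Function using (_∘_; case_of_)
open import Function.Bundles using (_⇔_; mk⇔)
open import Induction.WellFounded using (Acc; acc)
open import Relation.Binary.Definitions using (tri<; tri≈; tri>)
open import Relation.Binary.PropositionalEquality
  using (_≡_; _≢_; refl; sym; trans; cong; cong₂; subst; subst₂; module ≡-Reasoning)
open import Relation.Nullary using (¬_; yes; no; does)
open import Relation.Nullary.Decidable using (dec-true; dec-false)

map≡++⁻ : ∀ {A B : Set} (g : A → B) w xs {ys} → map g w ≡ xs ++ ys →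
  Σ (List A) λ w₁ → Σ (List A) λ w₂ → (w ≡ w₁ ++ w₂) × (map g w₁ ≡ xs) × (map g w₂ ≡ ys)
map≡++⁻ g w       []       e = [] , w , refl , refl , e
map≡++⁻ g (a ∷ w) (x ∷ xs) e with map≡++⁻ g w xs (∷-injectiveʳ e)
... | w₁ , w₂ , refl , refl , e₂ = a ∷ w₁ , w₂ , refl , cong (_∷ map g w₁) (∷-injectiveˡ e) , e₂

toList-tabulate : ∀ {A : Set} {k} (g : Fin k → A) → toList (tabulate g) ≡ List.tabulate g
toList-tabulate {k = zero}  g = refl
toList-tabulate {k = suc k} g = cong (g Fin.zero ∷_) (toList-tabulate (g ∘ Fin.suc))

Unique-toList-tabulate : ∀ {A : Set} {k} {g : Fin k → A} → (∀ {i j} → g i ≡ g j → i ≡ j) →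
  Unique (toList (tabulate g))
Unique-toList-tabulate {g = g} inj =
  subst Unique (sym (toList-tabulate g)) (AllPairsₚ.tabulate⁺ (λ i≢j gi≡gj → i≢j (inj gi≡gj)))

Unique-toList⇒lookup-injective : ∀ {A : Set} {k} (v : Vec A k) → Unique (toList v) →
  ∀ {i j} → lookup v i ≡ lookup v j → i ≡ j
Unique-toList⇒lookup-injective (x ∷ v) (x∉ ∷ u) {Fin.zero}  {Fin.zero}  _ = refl
Unique-toList⇒lookup-injective (x ∷ v) (x∉ ∷ u) {Fin.zero}  {Fin.suc j} e =
  ⊥-elim (All.lookup x∉ (∈-toList⁺ (∈-lookup j v)) e)
Unique-toList⇒lookup-injective (x ∷ v) (x∉ ∷ u) {Fin.suc i} {Fin.zero}  e =
  ⊥-elim (All.lookup x∉ (∈-toList⁺ (∈-lookup i v)) (sym e))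
Unique-toList⇒lookup-injective (x ∷ v) (x∉ ∷ u) {Fin.suc i} {Fin.suc j} e =
  cong Fin.suc (Unique-toList⇒lookup-injective v u e)

Unique-map⁺-on : ∀ {A B : Set} {g : A → B} {xs} → (∀ {x y} → x ∈ xs → y ∈ xs → g x ≡ g y → x ≡ y) →
  Unique xs → Unique (map g xs)
Unique-map⁺-on {xs = []}     _   []        = []
Unique-map⁺-on {xs = x ∷ xs} inj (x∉ ∷ u) =
  Allₚ.map⁺ (All.tabulate λ y∈ gx≡gy → All.lookup x∉ y∈ (inj (here refl) (there y∈) gx≡gy))
  ∷ Unique-map⁺-on (λ p q → inj (there p) (there q)) u

-- Intervals and the pattern 13-2

interval : ℕ → ℕ → List ℕ
interval k zero    = []
interval k (suc t) = k ∷ interval (suc k) t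

interval-++ : ∀ k s t → interval k s ++ interval (k + s) t ≡ interval k (s + t)
interval-++ k zero    t = cong (λ k′ → interval k′ t) (+-identityʳ k)
interval-++ k (suc s) t = cong (k ∷_) (trans (cong (λ k′ → interval (suc k) s ++ interval k′ t) (+-suc k s))
                                             (interval-++ (suc k) s t))

interval-++-∷ : ∀ k j xs → interval k j ++ (k + j) ∷ xs ≡ interval k (suc j) ++ xs
interval-++-∷ k zero    xs = cong (_∷ xs) (+-identityʳ k)
interval-++-∷ k (suc j) xs = cong (k ∷_) (trans (cong (λ k′ → interval (suc k) j ++ k′ ∷ xs) (+-suc k j))
                                                (interval-++-∷ (suc k) j xs))

∈-interval⁻ : ∀ {k t x} → x ∈ interval k t → k ≤ x × x < k + t
∈-interval⁻ {k} {suc t} (here refl) = ≤-refl , m<m+n k z<s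
∈-interval⁻ {k} {suc t} {x} (there p) with ∈-interval⁻ {suc k} {t} p
... | k<x , x<end = <⇒≤ k<x , subst (x <_) (sym (+-suc k t)) x<end

∈-interval⁺ : ∀ {k t x} → k ≤ x → x < k + t → x ∈ interval k t
∈-interval⁺ {k} {zero}  {x} k≤x x<k+0 = ⊥-elim (<⇒≱ (subst (x <_) (+-identityʳ k) x<k+0) k≤x)
∈-interval⁺ {k} {suc t} {x} k≤x x<end with m≤n⇒m<n∨m≡n k≤x
... | inj₂ refl = here refl
... | inj₁ k<x  = there (∈-interval⁺ k<x (subst (x <_) (+-suc k t) x<end))

Occurs13-2 : {A : Set} → (A → A → Set) → List A → Set
Occurs13-2 {A} _≺_ w = Σ (List A) λ xs → Σ A λ a → Σ A λ b →
  Σ (List A) λ ys → Σ A λ c → Σ (List A) λ zs →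
  (w ≡ xs ++ (a ∷ b ∷ (ys ++ (c ∷ zs)))) × (a ≺ c) × (c ≺ b)

module _ {A : Set} {_≺_ : A → A → Set} where

  Occurs13-2-++⁺ʳ : ∀ p {w} → Occurs13-2 _≺_ w → Occurs13-2 _≺_ (p ++ w)
  Occurs13-2-++⁺ʳ p (xs , a , b , ys , c , zs , refl , a≺c , c≺b) =
    p ++ xs , a , b , ys , c , zs , sym (++-assoc p xs _) , a≺c , c≺b

module _ {A B : Set} {_≺_ : A → A → Set} {_≺′_ : B → B → Set} (g : A → B) where

  Occurs13-2-map⁺ : (∀ {x y} → x ≺ y → g x ≺′ g y) →
    ∀ {w} → Occurs13-2 _≺_ w → Occurs13-2 _≺′_ (map g w)
  Occurs13-2-map⁺ preserves (xs , a , b , ys , c , zs , refl , a≺c , c≺b) =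
    map g xs , g a , g b , map g ys , g c , map g zs ,
    trans (map-++ g xs _) (cong (λ r → map g xs ++ g a ∷ g b ∷ r) (map-++ g ys _)) ,
    preserves a≺c , preserves c≺b

  Occurs13-2-map⁻ : (∀ {x y} → g x ≺′ g y → x ≺ y) →
    ∀ {w} → Occurs13-2 _≺′_ (map g w) → Occurs13-2 _≺_ w
  Occurs13-2-map⁻ reflects {w} (xs , a , b , ys , c , zs , e , a≺c , c≺b) with map≡++⁻ g w xs e
  ... | w₁ , []          , _    , _ , ()
  ... | w₁ , _ ∷ []      , _    , _ , ()
  ... | w₁ , a′ ∷ b′ ∷ w₃ , refl , _ , e₂ with map≡++⁻ g w₃ ys (∷-injectiveʳ (∷-injectiveʳ e₂))
  ...   | w₄ , []      , _    , _ , ()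
  ...   | w₄ , c′ ∷ w₆ , refl , _ , e₅ =
    w₁ , a′ , b′ , w₄ , c′ , w₆ , refl ,
    reflects (subst₂ _≺′_ (sym ga′) (sym gc′) a≺c) , reflects (subst₂ _≺′_ (sym gc′) (sym gb′) c≺b)
    where
    ga′ = ∷-injectiveˡ e₂
    gb′ = ∷-injectiveˡ (∷-injectiveʳ e₂)
    gc′ = ∷-injectiveˡ e₅

interval-adjacent : ∀ k t p {a b q} → interval k t ≡ p ++ a ∷ b ∷ q → b ≡ suc a
interval-adjacent k zero          []      ()
interval-adjacent k (suc zero)    []      ()
interval-adjacent k (suc (suc t)) []      refl = refl
interval-adjacent k zero          (_ ∷ p) ()
interval-adjacent k (suc t)       (_ ∷ p) e    = interval-adjacent (suc k) t p (∷-injectiveʳ e)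

interval-avoids13-2 : ∀ k t → ¬ Occurs13-2 _<_ (interval k t)
interval-avoids13-2 k t (xs , a , b , ys , c , zs , e , a<c , c<b) =
  <⇒≱ a<c (≤-pred (subst (c <_) (interval-adjacent k t xs e) c<b))

-- Otherwise a, b, suc a would be an occurrence.
avoids13-2⇒≤suc : ∀ P {a b Q} → ¬ Occurs13-2 _<_ (P ++ a ∷ b ∷ Q) →
  suc a ∈ P ++ a ∷ b ∷ Q → suc a ∉ P → b ≤ suc a
avoids13-2⇒≤suc P {a} {b} {Q} avoid sa∈W sa∉P = ≮⇒≥ jump
  where
  jump : ¬ suc a < b
  jump sa<b with ∈-++⁻ P sa∈W
  ... | inj₁ sa∈P                    = sa∉P sa∈P
  ... | inj₂ (here sa≡a)             = 1+n≢n sa≡a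
  ... | inj₂ (there (here sa≡b))     = <-irrefl sa≡b sa<b
  ... | inj₂ (there (there sa∈Q)) with ∈-∃++ sa∈Q
  ...   | ys , zs , Q≡ = avoid (P , a , b , ys , suc a , zs ,
                                cong (λ r → P ++ a ∷ b ∷ r) Q≡ , n<1+n a , sa<b)

-- Compositions

-- A composition of a number into parts l₁ + 1, …, lᵣ + 1 is the list l₁ ∷ … ∷ lᵣ.
weight : List ℕ → ℕ
weight []      = 0
weight (l ∷ c) = suc l + weight c

lengthenFirst : List ℕ → List ℕ
lengthenFirst []      = []
lengthenFirst (l ∷ c) = suc l ∷ c

compositions : ℕ → List (List ℕ)
compositions zero    = [ [ 0 ] ]
compositions (suc m) = map (0 ∷_) (compositions m) ++ map lengthenFirst (compositions m)

length-compositions : ∀ m → length (compositions m) ≡ 2 ^ m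
length-compositions zero    = refl
length-compositions (suc m) = begin
  length (map (0 ∷_) (compositions m) ++ map lengthenFirst (compositions m))
    ≡⟨ length-++ (map (0 ∷_) (compositions m)) ⟩
  length (map (0 ∷_) (compositions m)) + length (map lengthenFirst (compositions m))
    ≡⟨ cong₂ _+_ (length-map (0 ∷_) (compositions m)) (length-map lengthenFirst (compositions m)) ⟩
  length (compositions m) + length (compositions m)
    ≡⟨ cong (λ r → r + r) (length-compositions m) ⟩
  2 ^ m + 2 ^ m
    ≡⟨ cong (2 ^ m +_) (sym (+-identityʳ (2 ^ m))) ⟩
  2 ^ suc m ∎
  where open ≡-Reasoning

∈-compositions⁻ : ∀ m {c} → c ∈ compositions m → weight c ≡ suc m
∈-compositions⁻ zero    (here refl) = refl
∈-compositions⁻ (suc m) {c} p with ∈-++⁻ (map (0 ∷_) (compositions m)) p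
... | inj₁ q with ∈-map⁻ (0 ∷_) q
...   | c′ , c′∈ , refl = cong suc (∈-compositions⁻ m c′∈)
∈-compositions⁻ (suc m) {c} p | inj₂ q with ∈-map⁻ lengthenFirst q
...   | []     , c′∈ , refl with () ← ∈-compositions⁻ m c′∈
...   | l ∷ c′ , c′∈ , refl = cong suc (∈-compositions⁻ m c′∈)

∈-compositions⁺ : ∀ m {c} → weight c ≡ suc m → c ∈ compositions m
∈-compositions⁺ zero    {zero ∷ []}     _ = here refl
∈-compositions⁺ zero    {zero ∷ _ ∷ _}  ()
∈-compositions⁺ zero    {suc _ ∷ _}     ()
∈-compositions⁺ (suc m) {zero ∷ c}  w =
  ∈-++⁺ˡ (∈-map⁺ (0 ∷_) (∈-compositions⁺ m (suc-injective w)))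
∈-compositions⁺ (suc m) {suc l ∷ c} w =
  ∈-++⁺ʳ (map (0 ∷_) (compositions m)) (∈-map⁺ lengthenFirst (∈-compositions⁺ m {l ∷ c} (suc-injective w)))

compositions-unique : ∀ m → Unique (compositions m)
compositions-unique zero    = All.[] ∷ []
compositions-unique (suc m) =
  Uniqueₚ.++⁺ (Uniqueₚ.map⁺ ∷-injectiveʳ (compositions-unique m))
             (Uniqueₚ.map⁺ lengthenFirst-injective (compositions-unique m)) disjoint
  where
  lengthenFirst-injective : ∀ {c c′} → lengthenFirst c ≡ lengthenFirst c′ → c ≡ c′
  lengthenFirst-injective {[]}    {[]}    _    = refl
  lengthenFirst-injective {[]}    {_ ∷ _} ()
  lengthenFirst-injective {_ ∷ _} {[]}    ()
  lengthenFirst-injective {_ ∷ _} {_ ∷ _} refl = refl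
  disjoint : ∀ {c} → ¬ (c ∈ map (0 ∷_) (compositions m) × c ∈ map lengthenFirst (compositions m))
  disjoint (p , q) with ∈-map⁻ (0 ∷_) p | ∈-map⁻ lengthenFirst q
  ... | _ , _ , refl | _ ∷ _ , _ , ()
  ... | _ , _ , refl | []    , _ , ()

-- Permutations made of cycles of consecutive letters

-- blockCycles c k cuts [k, k + weight c) into consecutive blocks of the sizes listed by c and
-- is the cycle (b b+1 … b+l) on each block; it is the identity beyond.
blockCycles : List ℕ → ℕ → ℕ → ℕ
blockCycles []      k x = x
blockCycles (l ∷ c) k x with <-cmp x (k + l)
... | tri< _ _ _ = suc x
... | tri≈ _ _ _ = k
... | tri> _ _ _ = blockCycles c (suc (k + l)) x

+-suc-assoc : ∀ k l w → k + suc (l + w) ≡ suc (k + l) + w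
+-suc-assoc k l w = trans (+-suc k (l + w)) (cong suc (sym (+-assoc k l w)))

module _ (l : ℕ) (c : List ℕ) (k : ℕ) where

  blockCycles-inside : ∀ {x} → x < k + l → blockCycles (l ∷ c) k x ≡ suc x
  blockCycles-inside {x} x<kl with <-cmp x (k + l)
  ... | tri< _ _ _    = refl
  ... | tri≈ _ x≡kl _ = ⊥-elim (<-irrefl x≡kl x<kl)
  ... | tri> _ _ x>kl = ⊥-elim (<-asym x<kl x>kl)

  blockCycles-last : blockCycles (l ∷ c) k (k + l) ≡ k
  blockCycles-last with <-cmp (k + l) (k + l)
  ... | tri< kl<kl _ _ = ⊥-elim (<-irrefl refl kl<kl)
  ... | tri≈ _ _ _     = refl
  ... | tri> _ _ kl>kl = ⊥-elim (<-irrefl refl kl>kl)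

  blockCycles-beyond : ∀ {x} → k + l < x → blockCycles (l ∷ c) k x ≡ blockCycles c (suc (k + l)) x
  blockCycles-beyond {x} x>kl with <-cmp x (k + l)
  ... | tri< x<kl _ _ = ⊥-elim (<-asym x<kl x>kl)
  ... | tri≈ _ x≡kl _ = ⊥-elim (<-irrefl (sym x≡kl) x>kl)
  ... | tri> _ _ _    = refl

blockCycles-≥ : ∀ c k {x} → k ≤ x → k ≤ blockCycles c k x
blockCycles-≥ []      k k≤x = k≤x
blockCycles-≥ (l ∷ c) k {x} k≤x with <-cmp x (k + l)
... | tri< _ _ _    = m≤n⇒m≤1+n k≤x
... | tri≈ _ _ _    = ≤-refl
... | tri> _ _ x>kl = ≤-trans (m≤n⇒m≤1+n (m≤m+n k l)) (blockCycles-≥ c (suc (k + l)) x>kl)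

blockCycles-< : ∀ c k {x} → x < k + weight c → blockCycles c k x < k + weight c
blockCycles-< []      k x<k+0 = x<k+0
blockCycles-< (l ∷ c) k {x} x<end with <-cmp x (k + l)
... | tri< x<kl _ _ = <-≤-trans (s≤s x<kl) (subst (_≤ k + weight (l ∷ c)) (+-suc k l)
                        (+-monoʳ-≤ k (s≤s (m≤m+n l (weight c)))))
... | tri≈ _ _ _    = m<m+n k z<s
... | tri> _ _ _    = subst (blockCycles c (suc (k + l)) x <_) (sym (+-suc-assoc k l (weight c)))
                        (blockCycles-< c (suc (k + l)) (subst (x <_) (+-suc-assoc k l (weight c)) x<end))

blockCycles-injectiveʳ : ∀ c k {x y} → k ≤ x → k ≤ y → blockCycles c k x ≡ blockCycles c k y → x ≡ y
blockCycles-injectiveʳ []      k _ _ e = e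
blockCycles-injectiveʳ (l ∷ c) k {x} {y} k≤x k≤y e with <-cmp x (k + l) | <-cmp y (k + l)
... | tri< _ _ _    | tri< _ _ _    = suc-injective e
... | tri≈ _ x≡ _   | tri≈ _ y≡ _   = trans x≡ (sym y≡)
... | tri> _ _ x>   | tri> _ _ y>   = blockCycles-injectiveʳ c (suc (k + l)) x> y> e
... | tri< _ _ _    | tri≈ _ _ _    = ⊥-elim (<-irrefl refl (subst (_≤ x) (sym e) k≤x))
... | tri≈ _ _ _    | tri< _ _ _    = ⊥-elim (<-irrefl refl (subst (_≤ y) e k≤y))
... | tri< x< _ _   | tri> _ _ y>   =
  ⊥-elim (<⇒≱ x< (≤-pred (subst (suc (k + l) ≤_) (sym e) (blockCycles-≥ c _ y>))))
... | tri> _ _ x>   | tri< y< _ _   =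
  ⊥-elim (<⇒≱ y< (≤-pred (subst (suc (k + l) ≤_) e (blockCycles-≥ c _ x>))))
... | tri≈ _ _ _    | tri> _ _ y>   =
  ⊥-elim (<⇒≱ (s≤s (m≤m+n k l)) (subst (suc (k + l) ≤_) (sym e) (blockCycles-≥ c _ y>)))
... | tri> _ _ x>   | tri≈ _ _ _    =
  ⊥-elim (<⇒≱ (s≤s (m≤m+n k l)) (subst (suc (k + l) ≤_) e (blockCycles-≥ c _ x>)))

blockCycles-differ : ∀ {l l′} c c′ k → l < l′ → blockCycles (l ∷ c) k (k + l) ≢ blockCycles (l′ ∷ c′) k (k + l)
blockCycles-differ {l} {l′} c c′ k l<l′ e = <-irrefl k≡1+k+l (s≤s (m≤m+n k l))
  where
  open ≡-Reasoning
  k≡1+k+l : k ≡ suc (k + l)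
  k≡1+k+l = begin
    k                               ≡⟨ blockCycles-last l c k ⟨
    blockCycles (l ∷ c) k (k + l)   ≡⟨ e ⟩
    blockCycles (l′ ∷ c′) k (k + l) ≡⟨ blockCycles-inside l′ c′ k (+-monoʳ-< k l<l′) ⟩
    suc (k + l)                     ∎

blockCycles-injectiveˡ : ∀ c c′ k → weight c ≡ weight c′ →
  (∀ x → k ≤ x → x < k + weight c → blockCycles c k x ≡ blockCycles c′ k x) → c ≡ c′
blockCycles-injectiveˡ []      []        k _  _  = refl
blockCycles-injectiveˡ (l ∷ c) (l′ ∷ c′) k w≡ agree with <-cmp l l′
... | tri< l<l′ _ _ = ⊥-elim (blockCycles-differ c c′ k l<l′
  (agree (k + l) (m≤m+n k l) (+-monoʳ-< k (s≤s (m≤m+n l (weight c))))))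
... | tri> _ _ l>l′ = ⊥-elim (blockCycles-differ c′ c k l>l′ (sym
  (agree (k + l′) (m≤m+n k l′) (+-monoʳ-< k (m<n⇒m<1+n (<-≤-trans l>l′ (m≤m+n l (weight c))))))))
... | tri≈ _ refl _ = cong (l ∷_) (blockCycles-injectiveˡ c c′ (suc (k + l))
  (+-cancelˡ-≡ (suc l) _ _ w≡)
  λ x k′≤x x<end → begin
    blockCycles c (suc (k + l)) x   ≡⟨ blockCycles-beyond l c k k′≤x ⟨
    blockCycles (l ∷ c) k x         ≡⟨ agree x (≤-trans (m≤n⇒m≤1+n (m≤m+n k l)) k′≤x)
                                         (subst (x <_) (sym (+-suc-assoc k l (weight c))) x<end) ⟩
    blockCycles (l ∷ c′) k x        ≡⟨ blockCycles-beyond l c′ k k′≤x ⟩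
    blockCycles c′ (suc (k + l)) x  ∎)
  where open ≡-Reasoning

-- Flatten of a self-map of ℕ

-- cycleN and flattenN are cycleFrom and flattenGo for a self-map f of ℕ in place of σ.
module FlattenMap (m : ℕ) (f : ℕ → ℕ) where

  n : ℕ
  n = suc m

  cycleN : ℕ → ℕ → ℕ → List ℕ
  cycleN s cur zero    = []
  cycleN s cur (suc t) = cur ∷ (if does (f cur ≟ s) then [] else cycleN s (f cur) t)

  flattenN : List ℕ → List ℕ → List ℕ
  flattenN vis []       = []
  flattenN vis (i ∷ is) =
    if does (i ∈? vis) then flattenN vis is else (cycleN i i n ++ flattenN (vis ++ cycleN i i n) is)

  cycleN-stop : ∀ {s cur} u → f cur ≡ s → cycleN s cur (suc u) ≡ [ cur ]
  cycleN-stop {s} {cur} u e rewrite dec-true (f cur ≟ s) e = refl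

  cycleN-step : ∀ {s cur} u → f cur ≢ s → cycleN s cur (suc u) ≡ cur ∷ cycleN s (f cur) u
  cycleN-step {s} {cur} u e rewrite dec-false (f cur ≟ s) e = refl

  flattenN-new : ∀ {vis i} is → i ∉ vis →
    flattenN vis (i ∷ is) ≡ cycleN i i n ++ flattenN (vis ++ cycleN i i n) is
  flattenN-new {vis} {i} is i∉ rewrite dec-false (i ∈? vis) i∉ = refl

  flattenN-skip : ∀ vis {p} q → All (_∈ vis) p → flattenN vis (p ++ q) ≡ flattenN vis q
  flattenN-skip vis q All.[]             = refl
  flattenN-skip vis {x ∷ _} q (x∈ All.∷ p∈) rewrite dec-true (x ∈? vis) x∈ = flattenN-skip vis q p∈

  flattenN-complete : ∀ vis is {y} → y ∈ is → y ∈ vis ⊎ y ∈ flattenN vis is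
  flattenN-complete vis (i ∷ is) y∈ with i ∈? vis
  flattenN-complete vis (i ∷ is) (here refl) | yes i∈ = inj₁ i∈
  flattenN-complete vis (i ∷ is) (there y∈)  | yes _  = flattenN-complete vis is y∈
  flattenN-complete vis (i ∷ is) (here refl) | no _   = inj₂ (here refl)
  flattenN-complete vis (i ∷ is) (there y∈)  | no _
    with flattenN-complete (vis ++ cycleN i i n) is y∈
  ... | inj₂ y∈rest = inj₂ (∈-++⁺ʳ (cycleN i i n) y∈rest)
  ... | inj₁ y∈vis′ with ∈-++⁻ vis y∈vis′
  ...   | inj₁ y∈vis = inj₁ y∈vis
  ...   | inj₂ y∈cyc = inj₂ (∈-++⁺ˡ y∈cyc)

  flattenN-covers : ∀ k t {z} → k ≤ z → z < k + t → z ∈ flattenN (interval 0 k) (interval k t)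
  flattenN-covers k t k≤z z<k+t with flattenN-complete (interval 0 k) (interval k t) (∈-interval⁺ k≤z z<k+t)
  ... | inj₁ z∈ = ⊥-elim (<⇒≱ (proj₂ (∈-interval⁻ z∈)) k≤z)
  ... | inj₂ z∈ = z∈

  record IsBlock (k l : ℕ) : Set where
    field
      end<n   : k + l < n
      ascends : ∀ x → k ≤ x → x < k + l → f x ≡ suc x
      returns : f (k + l) ≡ k

  cycleN-IsBlock : ∀ {k l} → IsBlock k l → cycleN k k n ≡ interval k (suc l)
  cycleN-IsBlock {k} {l} b = from l n k ≤-refl refl (≤-<-trans (m≤n+m l k) end<n)
    where
    open IsBlock b
    from : ∀ d u cur → k ≤ cur → cur + d ≡ k + l → d < u → cycleN k cur u ≡ interval cur (suc d)
    from zero    (suc u) cur _     e _ = cycleN-stop u (trans (cong f (trans (sym (+-identityʳ cur)) e)) returns)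
    from (suc d) (suc u) cur k≤cur e (s≤s d<u) = begin
      cycleN k cur (suc u)              ≡⟨ cycleN-step u (λ fcur≡k → <-irrefl refl (subst (_≤ cur) (trans (sym fcur≡k) asc) k≤cur)) ⟩
      cur ∷ cycleN k (f cur) u          ≡⟨ cong (λ c → cur ∷ cycleN k c u) asc ⟩
      cur ∷ cycleN k (suc cur) u        ≡⟨ cong (cur ∷_) (from d u (suc cur) (m≤n⇒m≤1+n k≤cur) (trans (sym (+-suc cur d)) e) d<u) ⟩
      interval cur (suc (suc d))        ∎
      where
      open ≡-Reasoning
      asc : f cur ≡ suc cur
      asc = ascends cur k≤cur (subst (cur <_) e (m<m+n cur z<s))

  flattenN-IsBlock : ∀ {k l} t → IsBlock k l →
    flattenN (interval 0 k) (interval k (suc l + t)) ≡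
    interval k (suc l) ++ flattenN (interval 0 (suc (k + l))) (interval (suc (k + l)) t)
  flattenN-IsBlock {k} {l} t b = begin
    flattenN (interval 0 k) (k ∷ interval (suc k) (l + t))
      ≡⟨ flattenN-new (interval (suc k) (l + t)) (λ k∈ → <-irrefl refl (proj₂ (∈-interval⁻ k∈))) ⟩
    cycleN k k n ++ flattenN (interval 0 k ++ cycleN k k n) (interval (suc k) (l + t))
      ≡⟨ cong (λ cyc → cyc ++ flattenN (interval 0 k ++ cyc) (interval (suc k) (l + t))) (cycleN-IsBlock b) ⟩
    interval k (suc l) ++ flattenN (interval 0 k ++ interval k (suc l)) (interval (suc k) (l + t))
      ≡⟨ cong (interval k (suc l) ++_) (cong₂ flattenN visited (sym (interval-++ (suc k) l t))) ⟩
    interval k (suc l) ++ flattenN (interval 0 (suc (k + l))) (interval (suc k) l ++ interval (suc (k + l)) t)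
      ≡⟨ cong (interval k (suc l) ++_) (flattenN-skip _ (interval (suc (k + l)) t) seen) ⟩
    interval k (suc l) ++ flattenN (interval 0 (suc (k + l))) (interval (suc (k + l)) t) ∎
    where
    open ≡-Reasoning
    visited : interval 0 k ++ interval k (suc l) ≡ interval 0 (suc (k + l))
    visited = trans (interval-++ 0 k (suc l)) (cong (interval 0) (+-suc k l))
    seen : All (_∈ interval 0 (suc (k + l))) (interval (suc k) l)
    seen = All.tabulate λ x∈ → ∈-interval⁺ {0} {suc (k + l)} z≤n (proj₂ (∈-interval⁻ x∈))

  Agrees : List ℕ → ℕ → Set
  Agrees c k = ∀ x → k ≤ x → x < n → f x ≡ blockCycles c k x

  Agrees-∷⁻ : ∀ {l c k} → k + weight (l ∷ c) ≡ n → Agrees (l ∷ c) k → IsBlock k l × Agrees c (suc (k + l))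
  Agrees-∷⁻ {l} {c} {k} end agree = block , λ x k′≤x x<n →
    trans (agree x (≤-trans (m≤n⇒m≤1+n (m≤m+n k l)) k′≤x) x<n) (blockCycles-beyond l c k k′≤x)
    where
    kl<n : k + l < n
    kl<n = subst (k + l <_) end (+-monoʳ-< k (s≤s (m≤m+n l (weight c))))
    block : IsBlock k l
    block = record
      { end<n   = kl<n
      ; ascends = λ x k≤x x<kl → trans (agree x k≤x (<-trans x<kl kl<n)) (blockCycles-inside l c k x<kl)
      ; returns = trans (agree (k + l) (m≤m+n k l) kl<n) (blockCycles-last l c k)
      }

  Agrees-∷⁺ : ∀ {l c k} → IsBlock k l → Agrees c (suc (k + l)) → Agrees (l ∷ c) k
  Agrees-∷⁺ {l} {c} {k} b agree x k≤x x<n with <-cmp x (k + l)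
  ... | tri< x<kl _ _    = IsBlock.ascends b x k≤x x<kl
  ... | tri≈ _ refl _    = IsBlock.returns b
  ... | tri> _ _ x>kl    = agree x x>kl x<n

  flattenN-blockCycles : ∀ c k → k + weight c ≡ n → Agrees c k →
    flattenN (interval 0 k) (interval k (weight c)) ≡ interval k (weight c)
  flattenN-blockCycles []      k _   _     = refl
  flattenN-blockCycles (l ∷ c) k end agree with Agrees-∷⁻ end agree
  ... | b , agree′ = begin
    flattenN (interval 0 k) (interval k (suc l + weight c))
      ≡⟨ flattenN-IsBlock (weight c) b ⟩
    interval k (suc l) ++ flattenN (interval 0 (suc (k + l))) (interval (suc (k + l)) (weight c))
      ≡⟨ cong (interval k (suc l) ++_)
              (flattenN-blockCycles c (suc (k + l)) (trans (sym (+-suc-assoc k l (weight c))) end) agree′) ⟩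
    interval k (suc l) ++ interval (suc (k + l)) (weight c)
      ≡⟨ cong (k ∷_) (interval-++ (suc k) l (weight c)) ⟩
    interval k (suc l + weight c) ∎
    where open ≡-Reasoning

  module Permutation (injective : ∀ {x y} → x < n → y < n → f x ≡ f y → x ≡ y)
                  (bounded : ∀ x → x < n → f x < n) where

    Closed : ℕ → Set
    Closed k = ∀ x → k ≤ x → x < n → k ≤ f x

    ascent-preimage : ∀ {k j y} → (∀ x → k ≤ x → x < k + j → f x ≡ suc x) → k + j < n →
      y < n → k < f y → f y ≤ k + j → suc y ≡ f y
    ascent-preimage {k} {j} {y} ascends kj<n y<n = from (f y) refl
      where
      from : ∀ z → f y ≡ z → k < z → z ≤ k + j → suc y ≡ z
      from (suc w) fy≡ (s≤s k≤w) w<kj =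
        cong suc (injective y<n (<-trans w<kj kj<n) (trans fy≡ (sym (ascends w k≤w w<kj))))

    Closed-IsBlock : ∀ {k l} → Closed k → IsBlock k l → Closed (suc (k + l))
    Closed-IsBlock {k} {l} closed b x k′≤x x<n = ≰⇒> λ fx≤kl →
      case m≤n⇒m<n∨m≡n (closed x (≤-trans (m≤n⇒m≤1+n (m≤m+n k l)) k′≤x) x<n) of λ where
        (inj₁ k<fx) → <⇒≱ k′≤x (<⇒≤ (subst (_≤ k + l) (sym (ascent-preimage ascends end<n x<n k<fx fx≤kl)) fx≤kl))
        (inj₂ k≡fx) → <-irrefl (sym (injective x<n end<n (trans (sym k≡fx) (sym returns)))) k′≤x
      where open IsBlock b

    firstCycle-IsBlock : ∀ {k R} → Closed k → k < n →
      (∀ z → k ≤ z → z < n → z ∈ cycleN k k n ++ R) →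
      ¬ Occurs13-2 _<_ (cycleN k k n ++ R) → Σ ℕ (IsBlock k)
    firstCycle-IsBlock {k} {R} closed k<n covers avoid =
      walk n 0 refl (subst (_< n) (sym (+-identityʳ k)) k<n)
        (λ x k≤x x<k+0 → ⊥-elim (<⇒≱ (subst (x <_) (+-identityʳ k) x<k+0) k≤x))
        (cong (λ s → cycleN k s n ++ R) (sym (+-identityʳ k)))
      where
      W : List ℕ
      W = cycleN k k n ++ R

      ≤suc-at-end : ∀ {j} → n ≤ suc (k + j) → k + j < n → f (k + j) ≤ suc (k + j)
      ≤suc-at-end n≤ kj<n = <⇒≤ (<-≤-trans (bounded _ kj<n) n≤)

      ≤suc : ∀ {j} u → j + suc u ≡ n → k + j < n →
        W ≡ interval k j ++ (k + j) ∷ cycleN k (f (k + j)) u ++ R → f (k + j) ≤ suc (k + j)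
      ≤suc {j} zero    j+1≡n kj<n _ =
        ≤suc-at-end (subst (_≤ suc (k + j)) (trans (+-comm 1 j) j+1≡n) (s≤s (m≤n+m j k))) kj<n
      ≤suc {j} (suc u) _ kj<n W≡ with suc (k + j) <? n
      ... | no ¬sk<n = ≤suc-at-end (≮⇒≥ ¬sk<n) kj<n
      ... | yes sk<n = avoids13-2⇒≤suc (interval k j)
        (avoid ∘ subst (Occurs13-2 _<_) (sym W≡))
        (subst (suc (k + j) ∈_) W≡ (covers (suc (k + j)) (m≤n⇒m≤1+n (m≤m+n k j)) sk<n))
        (λ sk∈ → <-asym (n<1+n (k + j)) (proj₂ (∈-interval⁻ sk∈)))

      ≥suc : ∀ {j} → (∀ x → k ≤ x → x < k + j → f x ≡ suc x) → k + j < n → f (k + j) ≢ k →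
        suc (k + j) ≤ f (k + j)
      ≥suc {j} ascends kj<n ¬returns = ≰⇒> λ f≤kj →
        case m≤n⇒m<n∨m≡n (closed (k + j) (m≤m+n k j) kj<n) of λ where
          (inj₁ k<f) → <-irrefl refl (subst (_≤ k + j) (sym (ascent-preimage ascends kj<n kj<n k<f f≤kj)) f≤kj)
          (inj₂ k≡f) → ¬returns (sym k≡f)

      walk : ∀ u j → j + u ≡ n → k + j < n → (∀ x → k ≤ x → x < k + j → f x ≡ suc x) →
        W ≡ interval k j ++ cycleN k (k + j) u ++ R → Σ ℕ (IsBlock k)
      walk zero    j j+0≡n kj<n _ _ = ⊥-elim (<⇒≱ kj<n (subst (_≤ k + j) (trans (sym (+-identityʳ j)) j+0≡n) (m≤n+m j k)))
      walk (suc u) j j+u≡n kj<n ascends W≡ with f (k + j) ≟ k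
      ... | yes returns = j , record { end<n = kj<n ; ascends = ascends ; returns = returns }
      ... | no ¬returns = walk u (suc j) (trans (sym (+-suc j u)) j+u≡n) ksj<n ascends′ W≡′
        where
        W≡step : W ≡ interval k j ++ (k + j) ∷ cycleN k (f (k + j)) u ++ R
        W≡step = trans W≡ (cong (λ cyc → interval k j ++ cyc ++ R) (cycleN-step u ¬returns))
        next : f (k + j) ≡ k + suc j
        next = trans (≤-antisym (≤suc u j+u≡n kj<n W≡step) (≥suc ascends kj<n ¬returns)) (sym (+-suc k j))
        ksj<n : k + suc j < n
        ksj<n = subst (_< n) next (bounded _ kj<n)
        ascends′ : ∀ x → k ≤ x → x < k + suc j → f x ≡ suc x
        ascends′ x k≤x x<ksj with m≤n⇒m<n∨m≡n (≤-pred (subst (suc x ≤_) (+-suc k j) x<ksj))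
        ... | inj₁ x<kj = ascends x k≤x x<kj
        ... | inj₂ refl = trans next (+-suc k j)
        W≡′ : W ≡ interval k (suc j) ++ cycleN k (k + suc j) u ++ R
        W≡′ = trans W≡step (trans (cong (λ s → interval k j ++ (k + j) ∷ cycleN k s u ++ R) next)
                                  (interval-++-∷ k j (cycleN k (k + suc j) u ++ R)))

    decompose : ∀ t → Acc _<_ t → ∀ k → k + t ≡ n → Closed k →
      ¬ Occurs13-2 _<_ (flattenN (interval 0 k) (interval k t)) →
      Σ (List ℕ) λ c → weight c ≡ t × Agrees c k
    decompose zero    _         k k+0≡n _ _ = [] , refl , λ x k≤x x<n →
      ⊥-elim (<⇒≱ x<n (subst (_≤ x) (trans (sym (+-identityʳ k)) k+0≡n) k≤x))
    decompose (suc t) (acc rec) k end closed avoid =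
      l ∷ c , cong suc (trans (cong (l +_) wc) l+t′≡t) , Agrees-∷⁺ b agree
      where
      starts : flattenN (interval 0 k) (interval k (suc t)) ≡
               cycleN k k n ++ flattenN (interval 0 k ++ cycleN k k n) (interval (suc k) t)
      starts = flattenN-new (interval (suc k) t) (λ k∈ → <-irrefl refl (proj₂ (∈-interval⁻ k∈)))
      first : Σ ℕ (IsBlock k)
      first = firstCycle-IsBlock closed (subst (k <_) end (m<m+n k z<s))
        (λ z k≤z z<n → subst (z ∈_) starts (flattenN-covers k (suc t) k≤z (subst (z <_) (sym end) z<n)))
        (avoid ∘ subst (Occurs13-2 _<_) (sym starts))
      l = proj₁ first
      b = proj₂ first
      t′ = t ∸ l
      l+t′≡t : l + t′ ≡ t
      l+t′≡t = m+[n∸m]≡n (≤-pred (+-cancelˡ-< k l (suc t) (subst (k + l <_) (sym end) (IsBlock.end<n b))))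
      avoid′ : ¬ Occurs13-2 _<_ (flattenN (interval 0 (suc (k + l))) (interval (suc (k + l)) t′))
      avoid′ o = avoid (subst (Occurs13-2 _<_)
        (sym (trans (cong (λ s → flattenN (interval 0 k) (interval k (suc s))) (sym l+t′≡t)) (flattenN-IsBlock t′ b)))
        (Occurs13-2-++⁺ʳ (interval k (suc l)) o))
      rest = decompose t′ (rec (s≤s (m∸n≤m t l))) (suc (k + l))
        (trans (sym (+-suc-assoc k l t′)) (trans (cong (λ s → k + suc s) l+t′≡t) end))
        (Closed-IsBlock closed b) avoid′
      c = proj₁ rest
      wc = proj₁ (proj₂ rest)
      agree = proj₂ (proj₂ rest)

    avoids13-2⇒blockCycles : ¬ Occurs13-2 _<_ (flattenN [] (interval 0 n)) →
      Σ (List ℕ) λ c → weight c ≡ n × Agrees c 0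
    avoids13-2⇒blockCycles = decompose n (<-wellFounded n) 0 refl (λ _ _ _ → z≤n)

-- Permutations as vectors

toℕ-mod : ∀ {m x} → x < suc m → toℕ (x mod suc m) ≡ x
toℕ-mod {m} {x} x<n = trans (toℕ-fromℕ< _) (m<n⇒m%n≡m x<n)

-- Indices are reduced mod suc m, so the values of extend σ outside [0, suc m) are junk.
extend : ∀ {m} → Vec (Fin (suc m)) (suc m) → ℕ → ℕ
extend {m} σ x = toℕ (lookup σ (x mod suc m))

extend-toℕ : ∀ {m} (σ : Vec (Fin (suc m)) (suc m)) i → extend σ (toℕ i) ≡ toℕ (lookup σ i)
extend-toℕ σ i = cong (toℕ ∘ lookup σ) (toℕ-injective (toℕ-mod (toℕ<n i)))

module FlattenOf {m} (σ : Vec (Fin (suc m)) (suc m)) = FlattenMap m (extend σ)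

map-toℕ-cycleFrom : ∀ {m} (σ : Vec (Fin (suc m)) (suc m)) s cur t →
  map toℕ (cycleFrom σ s cur t) ≡ FlattenOf.cycleN σ (toℕ s) (toℕ cur) t
map-toℕ-cycleFrom σ s cur zero    = refl
map-toℕ-cycleFrom σ s cur (suc t) with lookup σ cur Fin.≟ s
... | yes σcur≡s = sym (FlattenOf.cycleN-stop σ t (trans (extend-toℕ σ cur) (cong toℕ σcur≡s)))
... | no  σcur≢s = begin
  toℕ cur ∷ map toℕ (cycleFrom σ s (lookup σ cur) t)
    ≡⟨ cong (toℕ cur ∷_) (map-toℕ-cycleFrom σ s (lookup σ cur) t) ⟩
  toℕ cur ∷ FlattenOf.cycleN σ (toℕ s) (toℕ (lookup σ cur)) t
    ≡⟨ cong (λ x → toℕ cur ∷ FlattenOf.cycleN σ (toℕ s) x t) (extend-toℕ σ cur) ⟨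
  toℕ cur ∷ FlattenOf.cycleN σ (toℕ s) (extend σ (toℕ cur)) t
    ≡⟨ FlattenOf.cycleN-step σ t (σcur≢s ∘ toℕ-injective ∘ trans (sym (extend-toℕ σ cur))) ⟨
  FlattenOf.cycleN σ (toℕ s) (toℕ cur) (suc t) ∎
  where open ≡-Reasoning

map-toℕ-flattenGo : ∀ {m} (σ : Vec (Fin (suc m)) (suc m)) vis is →
  map toℕ (flattenGo σ vis is) ≡ FlattenOf.flattenN σ (map toℕ vis) (map toℕ is)
map-toℕ-flattenGo σ vis []       = refl
map-toℕ-flattenGo σ vis (i ∷ is)
  with DecMembership._∈?_ Fin._≟_ i vis | toℕ i ∈? map toℕ vis
... | yes _   | yes _  = map-toℕ-flattenGo σ vis is
... | yes i∈  | no i∉  = ⊥-elim (i∉ (∈-map⁺ toℕ i∈))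
... | no i∉   | yes i∈ with ∈-map⁻ toℕ i∈
...   | j , j∈ , i≡j = ⊥-elim (i∉ (subst (_∈ vis) (sym (toℕ-injective i≡j)) j∈))
map-toℕ-flattenGo {m} σ vis (i ∷ is) | no _ | no _ = begin
  map toℕ (cyc ++ flattenGo σ (vis ++ cyc) is)
    ≡⟨ map-++ toℕ cyc _ ⟩
  map toℕ cyc ++ map toℕ (flattenGo σ (vis ++ cyc) is)
    ≡⟨ cong (map toℕ cyc ++_) (trans (map-toℕ-flattenGo σ (vis ++ cyc) is)
                                       (cong (λ v → FlattenOf.flattenN σ v (map toℕ is)) (map-++ toℕ vis cyc))) ⟩
  map toℕ cyc ++ FlattenOf.flattenN σ (map toℕ vis ++ map toℕ cyc) (map toℕ is)
    ≡⟨ cong (λ c → c ++ FlattenOf.flattenN σ (map toℕ vis ++ c) (map toℕ is)) (map-toℕ-cycleFrom σ i i (suc m)) ⟩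
  cycN ++ FlattenOf.flattenN σ (map toℕ vis ++ cycN) (map toℕ is) ∎
  where
  open ≡-Reasoning
  cyc  = cycleFrom σ i i (suc m)
  cycN = FlattenOf.cycleN σ (toℕ i) (toℕ i) (suc m)

map-toℕ-allFin : ∀ n → map toℕ (allFin n) ≡ interval 0 n
map-toℕ-allFin n = trans (Listₚ.map-tabulate (λ i → i) toℕ) (from 0 n)
  where
  from : ∀ k n → List.tabulate (λ (i : Fin n) → k + toℕ i) ≡ interval k n
  from k zero    = refl
  from k (suc n) = cong₂ _∷_ (+-identityʳ k)
    (trans (Listₚ.tabulate-cong (λ i → +-suc k (toℕ i))) (from (suc k) n))

map-toℕ-Flatten : ∀ {m} (σ : Vec (Fin (suc m)) (suc m)) →
  map toℕ (Flatten σ) ≡ FlattenOf.flattenN σ [] (interval 0 (suc m))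
map-toℕ-Flatten {m} σ =
  trans (map-toℕ-flattenGo σ [] (allFin (suc m))) (cong (FlattenOf.flattenN σ []) (map-toℕ-allFin (suc m)))

blockVec : ∀ m → List ℕ → Vec (Fin (suc m)) (suc m)
blockVec m c = tabulate (λ i → blockCycles c 0 (toℕ i) mod suc m)

module _ {m : ℕ} (c : List ℕ) (w : weight c ≡ suc m) where

  toℕ-blockVec-entry : ∀ i → toℕ (blockCycles c 0 (toℕ i) mod suc m) ≡ blockCycles c 0 (toℕ i)
  toℕ-blockVec-entry i =
    toℕ-mod (subst (blockCycles c 0 (toℕ i) <_) w (blockCycles-< c 0 (subst (toℕ i <_) (sym w) (toℕ<n i))))

  toℕ-lookup-blockVec : ∀ i → toℕ (lookup (blockVec m c) i) ≡ blockCycles c 0 (toℕ i)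
  toℕ-lookup-blockVec i = trans (cong toℕ (lookup∘tabulate (λ j → blockCycles c 0 (toℕ j) mod suc m) i)) (toℕ-blockVec-entry i)

  blockVec-agrees : FlattenOf.Agrees (blockVec m c) c 0
  blockVec-agrees x _ x<n = trans (toℕ-lookup-blockVec (x mod suc m)) (cong (blockCycles c 0) (toℕ-mod x<n))

  blockVec-isPerm : IsPerm (blockVec m c)
  blockVec-isPerm = Unique-toList-tabulate λ {i} {j} e → toℕ-injective (blockCycles-injectiveʳ c 0 z≤n z≤n
    (trans (sym (toℕ-blockVec-entry i)) (trans (cong toℕ e) (toℕ-blockVec-entry j))))

  blockVec-avoids13-2 : ¬ Occ13-2 (Flatten (blockVec m c))
  blockVec-avoids13-2 o = interval-avoids13-2 0 (suc m)
    (subst (Occurs13-2 _<_) flat≡ (Occurs13-2-map⁺ {_≺_ = λ a b → toℕ a < toℕ b} toℕ (λ a<b → a<b) o))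
    where
    flat≡ : map toℕ (Flatten (blockVec m c)) ≡ interval 0 (suc m)
    flat≡ = trans (map-toℕ-Flatten (blockVec m c))
      (subst (λ t → FlattenOf.flattenN (blockVec m c) [] (interval 0 t) ≡ interval 0 t) w
        (FlattenOf.flattenN-blockCycles (blockVec m c) c 0 w blockVec-agrees))

blockVec-injective : ∀ {m c c′} → weight c ≡ suc m → weight c′ ≡ suc m → blockVec m c ≡ blockVec m c′ → c ≡ c′
blockVec-injective {m} {c} {c′} w w′ e = blockCycles-injectiveˡ c c′ 0 (trans w (sym w′)) λ x _ x<w →
  let x<n = subst (x <_) w x<w in
  trans (sym (blockVec-agrees c w x z≤n x<n))
        (trans (cong (λ σ → extend σ x) e) (blockVec-agrees c′ w′ x z≤n x<n))

extend-injective : ∀ {m} (σ : Vec (Fin (suc m)) (suc m)) → IsPerm σ →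
  ∀ {x y} → x < suc m → y < suc m → extend σ x ≡ extend σ y → x ≡ y
extend-injective σ perm x<n y<n e = trans (sym (toℕ-mod x<n))
  (trans (cong toℕ (Unique-toList⇒lookup-injective σ perm (toℕ-injective e))) (toℕ-mod y<n))

flattenN-avoids13-2 : ∀ {m} (σ : Vec (Fin (suc m)) (suc m)) → ¬ Occ13-2 (Flatten σ) →
  ¬ Occurs13-2 _<_ (FlattenOf.flattenN σ [] (interval 0 (suc m)))
flattenN-avoids13-2 σ avoid o = avoid (Occurs13-2-map⁻ {_≺_ = λ a b → toℕ a < toℕ b} toℕ (λ a<b → a<b)
    (subst (Occurs13-2 _<_) (sym (map-toℕ-Flatten σ)) o))

avoids13-2⇒blockVec : ∀ {m} (σ : Vec (Fin (suc m)) (suc m)) → IsPerm σ → ¬ Occ13-2 (Flatten σ) →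
  Σ (List ℕ) λ c → weight c ≡ suc m × σ ≡ blockVec m c
avoids13-2⇒blockVec {m} σ perm avoid = c , w , σ≡
  where
  open FlattenOf.Permutation σ (extend-injective σ perm) (λ _ _ → toℕ<n _)
  found = avoids13-2⇒blockCycles (flattenN-avoids13-2 σ avoid)
  c = proj₁ found
  w = proj₁ (proj₂ found)
  σ≡ : σ ≡ blockVec m c
  σ≡ = trans (sym (tabulate∘lookup σ)) (tabulate-cong λ i → toℕ-injective (begin
    toℕ (lookup σ i)                        ≡⟨ extend-toℕ σ i ⟨
    extend σ (toℕ i)                        ≡⟨ proj₂ (proj₂ found) (toℕ i) z≤n (toℕ<n i) ⟩
    blockCycles c 0 (toℕ i)                 ≡⟨ toℕ-blockVec-entry c w i ⟨
    toℕ (blockCycles c 0 (toℕ i) mod suc m) ∎))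
    where open ≡-Reasoning

corollary2p4 : (m : ℕ) → Σ (List (Vec (Fin (suc m)) (suc m))) λ L →
    Unique L
    × ((v : Vec (Fin (suc m)) (suc m)) → (v ∈ L) ⇔ (IsPerm v × ¬ Occ13-2 (Flatten v)))
    × (length L ≡ 2 ^ m)
corollary2p4 m =
  map (blockVec m) (compositions m) ,
  Unique-map⁺-on (λ p q → blockVec-injective (∈-compositions⁻ m p) (∈-compositions⁻ m q))
                 (compositions-unique m) ,
  (λ σ → mk⇔ (sound σ) (complete σ)) ,
  trans (length-map (blockVec m) (compositions m)) (length-compositions m)
  where
  sound : ∀ σ → σ ∈ map (blockVec m) (compositions m) → IsPerm σ × ¬ Occ13-2 (Flatten σ)
  sound σ σ∈ with ∈-map⁻ (blockVec m) σ∈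
  ... | c , c∈ , refl = blockVec-isPerm c (∈-compositions⁻ m c∈) , blockVec-avoids13-2 c (∈-compositions⁻ m c∈)

  listed : ∀ {σ} → Σ (List ℕ) (λ c → weight c ≡ suc m × σ ≡ blockVec m c) → σ ∈ map (blockVec m) (compositions m)
  listed (c , w , refl) = ∈-map⁺ (blockVec m) (∈-compositions⁺ m {c} w)

  complete : ∀ σ → IsPerm σ × ¬ Occ13-2 (Flatten σ) → σ ∈ map (blockVec m) (compositions m)
  complete σ (perm , avoid) = listed (avoids13-2⇒blockVec σ perm avoid)
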